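{- For $p=210$, we have $$C_p(x,y)=\frac{1-5x+8x^2-x^2y-4x^3+3x^3y-x^4y}{(1-2x)(1-4x+4x^2-x^2y+x^3y)}.$$
   Context: A Catalan word of length $n\geq 1$ is a word $w_1\ldots w_n$ over the non-negative integers with $w_1=0$ and $0\leq w_i\leq w_{i-1}+1$ for $2\leq i\leq n$; the empty word is the unique Catalan word of length $0$. A word $w$ contains the pattern $p=p_1\ldots p_k$ if there are indices $i_1<\cdots<i_k$ such that $w_{i_1}\ldots w_{i_k}$ is order-isomorphic to $p$ (for all $a,b$: $w_{i_a}<w_{i_b}$ iff $p_a<p_b$, and $w_{i_a}=w_{i_b}$ iff $p_a=p_b$); otherwise $w$ avoids $p$. $\mathcal{C}_n(p)$ is the set of Catalan words of length $n$ avoiding $p$. A descent of $w$ is an index $i$ with $w_i>w_{i+1}$. $C_p(x,y)=\sum_{n,k\geq 0}c_{n,k}x^ny^k$, where $c_{n,k}$ is the number of words in $\mathcal{C}_n(p)$ with exactly $k$ descents. -}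

module Defs where

open import Data.Nat using (ℕ; zero; suc; _∸_; _≤ᵇ_; _<ᵇ_; _≡ᵇ_)
open import Data.Bool using (Bool; true; false; _∧_; _∨_; not; if_then_else_)
open import Data.List using (List; []; _∷_; map; _++_; concatMap; upTo; zip)
open import Data.Product using (_×_; _,_)
open import Data.Integer using (ℤ; +_; -_) renaming (_+_ to _+ℤ_; _*_ to _*ℤ_)

steps-ok : ℕ → List ℕ → Bool
steps-ok prev []      = true
steps-ok prev (a ∷ w) = (a ≤ᵇ suc prev) ∧ steps-ok a w

isCatalan : List ℕ → Bool
isCatalan []      = true
isCatalan (a ∷ w) = (a ≡ᵇ 0) ∧ steps-ok a w

anyB : {A : Set} → (A → Bool) → List A → Bool
anyB f []      = false
anyB f (x ∷ xs) = f x ∨ anyB f xs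

allB : {A : Set} → (A → Bool) → List A → Bool
allB f []      = true
allB f (x ∷ xs) = f x ∧ allB f xs

countB : {A : Set} → (A → Bool) → List A → ℕ
countB f []       = 0
countB f (x ∷ xs) = (if f x then 1 else 0) Data.Nat.+ countB f xs

data Cmp : Set where
  lt eq gt : Cmp

cmp : ℕ → ℕ → Cmp
cmp a b = if a <ᵇ b then lt else (if a ≡ᵇ b then eq else gt)

_==c_ : Cmp → Cmp → Bool
lt ==c lt = true
eq ==c eq = true
gt ==c gt = true
_  ==c _  = false

orderIso : List ℕ → List ℕ → Bool
orderIso []      []      = true
orderIso (a ∷ s) (b ∷ p) =
  allB (λ { (c , d) → cmp a c ==c cmp b d }) (zip s p) ∧ orderIso s p
orderIso _       _       = false

subseqs : List ℕ → List (List ℕ)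
subseqs []      = [] ∷ []
subseqs (a ∷ w) = subseqs w ++ map (a ∷_) (subseqs w)

contains : List ℕ → List ℕ → Bool
contains p w = anyB (λ s → orderIso s p) (subseqs w)

avoids : List ℕ → List ℕ → Bool
avoids p w = not (contains p w)

des : List ℕ → ℕ
des []          = 0
des (a ∷ [])    = 0
des (a ∷ b ∷ w) = (if b <ᵇ a then 1 else 0) Data.Nat.+ des (b ∷ w)

-- Enumeration: all words of length n over {0,…,m-1}.
-- Every Catalan word of length n has all entries ≤ n-1, so words over
-- {0,…,n-1} of length n contain all Catalan words of length n.

words : ℕ → ℕ → List (List ℕ)
words zero    m = [] ∷ []
words (suc n) m = concatMap (λ a → map (a ∷_) (words n m)) (upTo m)

cnk : List ℕ → ℕ → ℕ → ℕ
cnk p n k = countB (λ w → isCatalan w ∧ avoids p w ∧ (des w ≡ᵇ k)) (words n n)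

-- Formal power series in x, y with integer coefficients, as coefficient
-- functions, and polynomials as lists of monomials (a , i , j) = a xⁱ yʲ.

Series : Set
Series = ℕ → ℕ → ℤ

Poly : Set
Poly = List (ℤ × ℕ × ℕ)

coeffP : Poly → Series
coeffP []                  n k = + 0
coeffP ((a , i , j) ∷ ps)  n k =
  (if (i ≡ᵇ n) ∧ (j ≡ᵇ k) then a else + 0) +ℤ coeffP ps n k

_⊛_ : Poly → Series → Series
([]                 ⊛ f) n k = + 0
(((a , i , j) ∷ ps) ⊛ f) n k =
  (if (i ≤ᵇ n) ∧ (j ≤ᵇ k) then a *ℤ f (n ∸ i) (k ∸ j) else + 0) +ℤ (ps ⊛ f) n k

infixr 7 _⊛_

Cser : List ℕ → Series
Cser p n k = + (cnk p n k)

pat210 : List ℕ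
pat210 = 2 ∷ 1 ∷ 0 ∷ []

num210 : Poly
num210 = (+ 1 , 0 , 0) ∷ (- (+ 5) , 1 , 0) ∷ (+ 8 , 2 , 0) ∷ (- (+ 1) , 2 , 1)
       ∷ (- (+ 4) , 3 , 0) ∷ (+ 3 , 3 , 1) ∷ (- (+ 1) , 4 , 1) ∷ []

den1 : Poly
den1 = (+ 1 , 0 , 0) ∷ (- (+ 2) , 1 , 0) ∷ []

den2 : Poly
den2 = (+ 1 , 0 , 0) ∷ (- (+ 4) , 1 , 0) ∷ (+ 4 , 2 , 0) ∷ (- (+ 1) , 2 , 1)
     ∷ (+ 1 , 3 , 1) ∷ []

-- Reading a Catalan word from left to right, after a prefix with maximum M
-- and largest smaller letter lo of an inversion (the floor), a continuation w keeps the
-- word 210-avoiding iff w avoids 210, has no letter below lo and no 21-pattern with top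
-- below M.  The next letter either repeats or raises the maximum, or descends from the
-- maximum to some floor p, after which the word can only climb by steps of 0 or 1 back to
-- M.  So the number of completions depends only on the distance from the last letter to
-- the maximum and to the floor, and obeys the recurrences T, F, S below.  Eliminating S
-- gives a relation between consecutive T's whose instances, over ℤ, show that
-- t(n) = T n 0 satisfies E(E − 2)³ t = y (E − 1)(E − 2) t for the shift E; this is the
-- denominator (1 − 2x)((1 − 2x)² − x²y(1 − x)), and the numerator is read off from the
-- coefficients of xⁿ for n ≤ 4.
module Submission where

open import Defs
open import Data.Bool using (Bool; true; false; _∧_; _∨_; not; if_then_else_)
open import Data.Bool.Properties
  using (∨-assoc; ∨-comm; ∨-zeroʳ; ∨-identityʳ; ∧-assoc; ∧-zeroʳ; ∧-identityʳ; ∧-distribˡ-∨; T-≡)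
open import Data.Empty using (⊥-elim)
open import Data.List using (List; []; _∷_; map; _++_; concatMap; applyUpTo; null)
open import Data.Nat using (ℕ; zero; suc; _+_; _∸_; _≤_; _<_; s≤s; z<s; s<s; _≤ᵇ_; _<ᵇ_; _≡ᵇ_)
open import Data.Nat.Properties
open import Data.Nat.Tactic.RingSolver using (solve-∀; solve)
open import Agda.Builtin.Int using (pos)
open import Data.Integer using (ℤ; -_) renaming (_+_ to _+ℤ_; _-_ to _-ℤ_; _*_ to _*ℤ_)
open import Data.Integer.Properties using (i≡j⇒i-j≡0)
open import Data.Integer.Tactic.RingSolver using () renaming (solve to ℤsolve; solve-∀ to ℤsolve-∀)
open import Data.Product using (_,_)
open import Function using (id; _∘_; Equivalence)
open import Relation.Binary.PropositionalEquality

<ᵇ≡true : ∀ {m n} → m < n → (m <ᵇ n) ≡ true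
<ᵇ≡true = Equivalence.to T-≡ ∘ <⇒<ᵇ

<ᵇ≡true⇒< : ∀ {m n} → (m <ᵇ n) ≡ true → m < n
<ᵇ≡true⇒< {m} {n} = <ᵇ⇒< m n ∘ Equivalence.from T-≡

<ᵇ≡false : ∀ {m n} → n ≤ m → (m <ᵇ n) ≡ false
<ᵇ≡false {m} {n} n≤m with m <ᵇ n in m<ᵇn
... | false = refl
... | true  = ⊥-elim (<⇒≱ (<ᵇ≡true⇒< m<ᵇn) n≤m)

≤ᵇ≡true : ∀ {m n} → m ≤ n → (m ≤ᵇ n) ≡ true
≤ᵇ≡true = Equivalence.to T-≡ ∘ ≤⇒≤ᵇ

≤ᵇ≡false : ∀ {m n} → n < m → (m ≤ᵇ n) ≡ false
≤ᵇ≡false {suc m} n<m = <ᵇ≡false (≤-pred n<m)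

-- Occurrences of 210

anyB-++ : ∀ {A : Set} (f : A → Bool) xs ys → anyB f (xs ++ ys) ≡ anyB f xs ∨ anyB f ys
anyB-++ f []       ys = refl
anyB-++ f (x ∷ xs) ys = trans (cong (f x ∨_) (anyB-++ f xs ys)) (sym (∨-assoc (f x) _ _))

anyB-map : ∀ {A B : Set} (f : B → Bool) (g : A → B) xs → anyB f (map g xs) ≡ anyB (f ∘ g) xs
anyB-map f g []       = refl
anyB-map f g (x ∷ xs) = cong (f (g x) ∨_) (anyB-map f g xs)

anyB-cong : ∀ {A : Set} {f g : A → Bool} → (∀ x → f x ≡ g x) → ∀ xs → anyB f xs ≡ anyB g xs
anyB-cong f≗g []       = refl
anyB-cong f≗g (x ∷ xs) = cong₂ _∨_ (f≗g x) (anyB-cong f≗g xs)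

anyB-∧ : ∀ {A : Set} b (g : A → Bool) xs → anyB (λ x → b ∧ g x) xs ≡ b ∧ anyB g xs
anyB-∧ b g []       = sym (∧-zeroʳ b)
anyB-∧ b g (x ∷ xs) = trans (cong (b ∧ g x ∨_) (anyB-∧ b g xs)) (sym (∧-distribˡ-∨ b (g x) _))

anyB-subseqs-∷ : ∀ (f : List ℕ → Bool) a w →
  anyB f (subseqs (a ∷ w)) ≡ anyB f (subseqs w) ∨ anyB (f ∘ (a ∷_)) (subseqs w)
anyB-subseqs-∷ f a w =
  trans (anyB-++ f (subseqs w) _) (cong (anyB f (subseqs w) ∨_) (anyB-map f (a ∷_) (subseqs w)))

anyB-null-subseqs : ∀ w → anyB null (subseqs w) ≡ true
anyB-null-subseqs []      = refl
anyB-null-subseqs (a ∷ w) =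
  trans (anyB-subseqs-∷ null a w)
        (cong (_∨ anyB (λ _ → false) (subseqs w)) (anyB-null-subseqs w))

hasBelow : ℕ → List ℕ → Bool
hasBelow t []      = false
hasBelow t (c ∷ w) = (c <ᵇ t) ∨ hasBelow t w

has21Below : ℕ → List ℕ → Bool
has21Below t []      = false
has21Below t (b ∷ w) = has21Below t w ∨ ((b <ᵇ t) ∧ hasBelow b w)

has210 : List ℕ → Bool
has210 []      = false
has210 (a ∷ w) = has210 w ∨ has21Below a w

cmp-gt : ∀ a b → (cmp a b ==c gt) ≡ (b <ᵇ a)
cmp-gt zero    zero    = refl
cmp-gt zero    (suc b) = refl
cmp-gt (suc a) zero    = refl
cmp-gt (suc a) (suc b) = cmp-gt a b

orderIso-210 : ∀ a b c s → orderIso (a ∷ b ∷ c ∷ s) pat210 ≡ ((b <ᵇ a) ∧ (c <ᵇ b)) ∧ null s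
orderIso-210 a b c (_ ∷ _) =
  trans (cong (a-vs-bc ∧_) (∧-zeroʳ ((cmp b c ==c gt) ∧ true)))
        (trans (∧-zeroʳ a-vs-bc) (sym (∧-zeroʳ ((b <ᵇ a) ∧ (c <ᵇ b)))))
  where a-vs-bc = (cmp a b ==c gt) ∧ ((cmp a c ==c gt) ∧ true)
orderIso-210 a b c [] rewrite cmp-gt a b | cmp-gt a c | cmp-gt b c
  with b <ᵇ a in b<a | c <ᵇ b in c<b | c <ᵇ a in c<a
... | false | _     | _     = refl
... | true  | false | false = refl
... | true  | false | true  = refl
... | true  | true  | true  = refl
... | true  | true  | false with () ←
  trans (sym (<ᵇ≡true (<-trans (<ᵇ≡true⇒< {c} {b} c<b) (<ᵇ≡true⇒< {b} {a} b<a)))) c<a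

anyB-210-from₂ : ∀ a b w →
  anyB (λ s → orderIso (a ∷ b ∷ s) pat210) (subseqs w) ≡ (b <ᵇ a) ∧ hasBelow b w
anyB-210-from₂ a b [] rewrite cmp-gt a b with b <ᵇ a
... | true  = refl
... | false = refl
anyB-210-from₂ a b (c ∷ w) = begin
    anyB (λ s → orderIso (a ∷ b ∷ s) pat210) (subseqs (c ∷ w))
  ≡⟨ anyB-subseqs-∷ _ c w ⟩
    anyB (λ s → orderIso (a ∷ b ∷ s) pat210) (subseqs w)
      ∨ anyB (λ s → orderIso (a ∷ b ∷ c ∷ s) pat210) (subseqs w)
  ≡⟨ cong₂ _∨_ (anyB-210-from₂ a b w) with-c ⟩
    ((b <ᵇ a) ∧ hasBelow b w) ∨ (b <ᵇ a) ∧ (c <ᵇ b)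
  ≡⟨ trans (∨-comm ((b <ᵇ a) ∧ hasBelow b w) _) (sym (∧-distribˡ-∨ (b <ᵇ a) (c <ᵇ b) _)) ⟩
    (b <ᵇ a) ∧ hasBelow b (c ∷ w) ∎
  where
  open ≡-Reasoning
  with-c : anyB (λ s → orderIso (a ∷ b ∷ c ∷ s) pat210) (subseqs w) ≡ (b <ᵇ a) ∧ (c <ᵇ b)
  with-c = begin
      anyB (λ s → orderIso (a ∷ b ∷ c ∷ s) pat210) (subseqs w)
    ≡⟨ anyB-cong (orderIso-210 a b c) (subseqs w) ⟩
      anyB (λ s → ((b <ᵇ a) ∧ (c <ᵇ b)) ∧ null s) (subseqs w)
    ≡⟨ anyB-∧ _ null (subseqs w) ⟩
      ((b <ᵇ a) ∧ (c <ᵇ b)) ∧ anyB null (subseqs w)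
    ≡⟨ cong (((b <ᵇ a) ∧ (c <ᵇ b)) ∧_) (anyB-null-subseqs w) ⟩
      ((b <ᵇ a) ∧ (c <ᵇ b)) ∧ true
    ≡⟨ ∧-identityʳ _ ⟩
      (b <ᵇ a) ∧ (c <ᵇ b) ∎

anyB-210-from₁ : ∀ a w → anyB (λ s → orderIso (a ∷ s) pat210) (subseqs w) ≡ has21Below a w
anyB-210-from₁ a []      = refl
anyB-210-from₁ a (b ∷ w) =
  trans (anyB-subseqs-∷ _ b w) (cong₂ _∨_ (anyB-210-from₁ a w) (anyB-210-from₂ a b w))

contains-210 : ∀ w → contains pat210 w ≡ has210 w
contains-210 []      = refl
contains-210 (a ∷ w) =
  trans (anyB-subseqs-∷ _ a w) (cong₂ _∨_ (contains-210 w) (anyB-210-from₁ a w))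

hasBelow-mono : ∀ {t t′} → t ≤ t′ → ∀ w → hasBelow t w ≡ true → hasBelow t′ w ≡ true
hasBelow-mono {t} t≤t′ (c ∷ w) below with c <ᵇ t in c<t
... | true  rewrite <ᵇ≡true (<-≤-trans (<ᵇ≡true⇒< c<t) t≤t′) = refl
... | false rewrite hasBelow-mono t≤t′ w below = ∨-zeroʳ _

has21Below-mono : ∀ {t t′} → t ≤ t′ → ∀ w → has21Below t w ≡ true → has21Below t′ w ≡ true
has21Below-mono {t} t≤t′ (b ∷ w) found with has21Below t w in inner
... | true  rewrite has21Below-mono t≤t′ w inner = refl
... | false with b <ᵇ t in b<t | hasBelow b w in below
...   | true | true rewrite <ᵇ≡true (<-≤-trans (<ᵇ≡true⇒< b<t) t≤t′) = ∨-zeroʳ _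

has21Below⇒hasBelow : ∀ t w → has21Below t w ≡ true → hasBelow t w ≡ true
has21Below⇒hasBelow t (b ∷ w) found with has21Below t w in inner
... | true  rewrite has21Below⇒hasBelow t w inner = ∨-zeroʳ _
... | false with b <ᵇ t
...   | true = refl

hasBelow-zero : ∀ w → hasBelow 0 w ≡ false
hasBelow-zero []      = refl
hasBelow-zero (c ∷ w) = hasBelow-zero w

has21Below-zero : ∀ w → has21Below 0 w ≡ false
has21Below-zero []      = refl
has21Below-zero (b ∷ w) rewrite has21Below-zero w = refl

-- w can follow a 210-avoiding prefix with maximum M in which every inversion b > c has c ≤ lo.
admissible : ℕ → ℕ → List ℕ → Bool
admissible M lo w = not (has210 w ∨ hasBelow lo w ∨ has21Below M w)

admissible-∷-below : ∀ {a lo} M w → a < lo → admissible M lo (a ∷ w) ≡ false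
admissible-∷-below M w a<lo rewrite <ᵇ≡true a<lo = cong not (∨-zeroʳ _)

admissible-∷-inner : ∀ {a lo M} w → lo ≤ a → a < M → admissible M lo (a ∷ w) ≡ admissible M a w
admissible-∷-inner {a} {lo} {M} w lo≤a a<M rewrite <ᵇ≡false lo≤a | <ᵇ≡true a<M =
  cong not (absorb (has210 w) (has21Below a w) (hasBelow lo w) (has21Below M w) (hasBelow a w)
                   (has21Below⇒hasBelow a w) (hasBelow-mono lo≤a w))
  where
  absorb : ∀ p q r s t → (q ≡ true → t ≡ true) → (r ≡ true → t ≡ true) →
           (p ∨ q) ∨ r ∨ s ∨ t ≡ p ∨ t ∨ s
  absorb true  q     r     s t _   _   = refl
  absorb false true  r     s t q⇒t _   rewrite q⇒t refl = refl
  absorb false false true  s t _   r⇒t rewrite r⇒t refl = refl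
  absorb false false false s t _   _   = ∨-comm s t

admissible-∷-outer : ∀ {a lo M} w → lo ≤ a → M ≤ a → admissible M lo (a ∷ w) ≡ admissible a lo w
admissible-∷-outer {a} {lo} {M} w lo≤a M≤a rewrite <ᵇ≡false lo≤a | <ᵇ≡false M≤a =
  cong not (absorb (has210 w) (has21Below a w) (hasBelow lo w) (has21Below M w)
                   (has21Below-mono M≤a w))
  where
  absorb : ∀ p q r s → (s ≡ true → q ≡ true) → (p ∨ q) ∨ r ∨ s ∨ false ≡ p ∨ r ∨ q
  absorb true  q     r s     _   = refl
  absorb false true  r s     _   = sym (∨-zeroʳ r)
  absorb false false r false _   = refl
  absorb false false r true  s⇒q with () ← s⇒q refl

sumBelow : (ℕ → ℕ) → ℕ → ℕ
sumBelow h zero    = 0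
sumBelow h (suc m) = h 0 + sumBelow (h ∘ suc) m

sumBelow-cong : ∀ n {f g} → (∀ i → i < n → f i ≡ g i) → sumBelow f n ≡ sumBelow g n
sumBelow-cong zero    f≗g = refl
sumBelow-cong (suc n) f≗g = cong₂ _+_ (f≗g 0 z<s) (sumBelow-cong n (λ i i<n → f≗g (suc i) (s<s i<n)))

sumBelow-zero : ∀ n {f} → (∀ i → i < n → f i ≡ 0) → sumBelow f n ≡ 0
sumBelow-zero zero    f≗0 = refl
sumBelow-zero (suc n) f≗0 rewrite f≗0 0 z<s = sumBelow-zero n (λ i i<n → f≗0 (suc i) (s<s i<n))

sumBelow-+ : ∀ f p q → sumBelow f (p + q) ≡ sumBelow f p + sumBelow (λ i → f (p + i)) q
sumBelow-+ f zero    q = refl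
sumBelow-+ f (suc p) q = trans (cong (f 0 +_) (sumBelow-+ (f ∘ suc) p q)) (sym (+-assoc (f 0) _ _))

sumBelow-snoc : ∀ f n → sumBelow f (suc n) ≡ sumBelow f n + f n
sumBelow-snoc f zero    = +-identityʳ (f 0)
sumBelow-snoc f (suc n) = trans (cong (f 0 +_) (sumBelow-snoc (f ∘ suc) n)) (sym (+-assoc (f 0) _ _))

sumBelow-window : ∀ h lo len m → len + lo ≤ m →
  (∀ i → i < lo → h i ≡ 0) → (∀ i → len + lo ≤ i → h i ≡ 0) →
  sumBelow h m ≡ sumBelow (λ j → h (j + lo)) len
sumBelow-window h lo len m len+lo≤m below above = begin
    sumBelow h m
  ≡⟨ cong (sumBelow h) m≡lo+[len+rest] ⟩
    sumBelow h (lo + (len + rest))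
  ≡⟨ sumBelow-+ h lo (len + rest) ⟩
    sumBelow h lo + sumBelow (λ i → h (lo + i)) (len + rest)
  ≡⟨ cong₂ _+_ (sumBelow-zero lo below) (sumBelow-+ (λ i → h (lo + i)) len rest) ⟩
    sumBelow (λ i → h (lo + i)) len + sumBelow (λ i → h (lo + (len + i))) rest
  ≡⟨ cong₂ _+_ (sumBelow-cong len (λ i _ → cong h (+-comm lo i)))
               (sumBelow-zero rest (λ i _ → above _ (len+lo≤lo+[len+i] i))) ⟩
    sumBelow (λ j → h (j + lo)) len + 0
  ≡⟨ +-identityʳ _ ⟩
    sumBelow (λ j → h (j + lo)) len ∎
  where
  open ≡-Reasoning
  rest = m ∸ (len + lo)
  len+lo≤lo+[len+i] : ∀ i → len + lo ≤ lo + (len + i)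
  len+lo≤lo+[len+i] i = ≤-trans (≤-reflexive (+-comm len lo)) (+-monoʳ-≤ lo (m≤m+n len i))
  m≡lo+[len+rest] : m ≡ lo + (len + rest)
  m≡lo+[len+rest] = begin
    m                     ≡⟨ m+[n∸m]≡n len+lo≤m ⟨
    len + lo + rest       ≡⟨ cong (_+ rest) (+-comm len lo) ⟩
    lo + len + rest       ≡⟨ +-assoc lo len rest ⟩
    lo + (len + rest)     ∎

countB-++ : ∀ {A : Set} (f : A → Bool) xs ys → countB f (xs ++ ys) ≡ countB f xs + countB f ys
countB-++ f []       ys = refl
countB-++ f (x ∷ xs) ys =
  trans (cong (_ +_) (countB-++ f xs ys)) (sym (+-assoc (if f x then 1 else 0) _ _))

countB-map : ∀ {A B : Set} (f : B → Bool) (g : A → B) xs → countB f (map g xs) ≡ countB (f ∘ g) xs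
countB-map f g []       = refl
countB-map f g (x ∷ xs) = cong (_ +_) (countB-map f g xs)

countB-cong : ∀ {A : Set} {f g : A → Bool} → (∀ x → f x ≡ g x) → ∀ xs → countB f xs ≡ countB g xs
countB-cong f≗g []       = refl
countB-cong f≗g (x ∷ xs) = cong₂ _+_ (cong (if_then 1 else 0) (f≗g x)) (countB-cong f≗g xs)

countB-none : ∀ {A : Set} {f : A → Bool} → (∀ x → f x ≡ false) → ∀ xs → countB f xs ≡ 0
countB-none f≗false []       = refl
countB-none f≗false (x ∷ xs) rewrite f≗false x = countB-none f≗false xs

countB-words-suc : ∀ (f : List ℕ → Bool) n m →
  countB f (words (suc n) m) ≡ sumBelow (λ a → countB (f ∘ (a ∷_)) (words n m)) m
countB-words-suc f n m = go id m
  where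
  go : ∀ g j → countB f (concatMap (λ a → map (a ∷_) (words n m)) (applyUpTo g j))
             ≡ sumBelow (λ i → countB (f ∘ (g i ∷_)) (words n m)) j
  go g zero    = refl
  go g (suc j) = trans (countB-++ f (map (g 0 ∷_) (words n m)) _)
                       (cong₂ _+_ (countB-map f (g 0 ∷_) (words n m)) (go (g ∘ suc) j))

-- Counting continuations

-- Multiplication by y: the descent count goes up by one.
shiftY : (ℕ → ℕ) → ℕ → ℕ
shiftY f zero    = 0
shiftY f (suc k) = f k

shiftY-cong : ∀ {f g} → (∀ k → f k ≡ g k) → ∀ k → shiftY f k ≡ shiftY g k
shiftY-cong f≗g zero    = refl
shiftY-cong f≗g (suc k) = f≗g k

shiftY-+ : ∀ f g k → shiftY (λ k → f k + g k) k ≡ shiftY f k + shiftY g k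
shiftY-+ f g zero    = refl
shiftY-+ f g (suc k) = refl

-- T r e k counts the continuations of length r with k descents after a prefix ending in its
-- maximum M with floor M ∸ e; F r d k does the same after a prefix ending in its floor p
-- with maximum p + suc d.  A descent from M to the letter M ∸ e + j leads to state F with
-- d = e ∸ suc j, so S r e = F r (e ∸ 1) + ⋯ + F r 0 collects all descents.
mutual
  T : ℕ → ℕ → ℕ → ℕ
  T zero    e zero    = 1
  T zero    e (suc k) = 0
  T (suc r) e k       = shiftY (S r e) k + T r e k + T r (suc e) k

  F : ℕ → ℕ → ℕ → ℕ
  F zero    d       zero    = 1
  F zero    d       (suc k) = 0
  F (suc r) zero    k       = F r zero k + T r 1 k
  F (suc r) (suc d) k       = F r (suc d) k + F r d k

  S : ℕ → ℕ → ℕ → ℕ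
  S r zero    k = 0
  S r (suc e) k = F r e k + S r e k

S≡sumBelow : ∀ r e k → S r e k ≡ sumBelow (λ j → F r (e ∸ suc j) k) e
S≡sumBelow r zero    k = refl
S≡sumBelow r (suc e) k = cong (F r e k +_) (S≡sumBelow r e k)

continues : (last M lo k : ℕ) → List ℕ → Bool
continues last M lo k w = (steps-ok last w ∧ admissible M lo w) ∧ (des (last ∷ w) ≡ᵇ k)

-- words r m only uses letters below m; the bounds on m below make sure no continuation is missed.
count : (m r last M lo k : ℕ) → ℕ
count m r last M lo k = countB (continues last M lo k) (words r m)

countAfter : (m r last M lo k a : ℕ) → ℕ
countAfter m r last M lo k a = countB (continues last M lo k ∘ (a ∷_)) (words r m)

module _ (m r k : ℕ) {last M lo a : ℕ} where

  countAfter-below : a < lo → countAfter m r last M lo k a ≡ 0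
  countAfter-below a<lo = countB-none continues-∷ (words r m)
    where
    continues-∷ : ∀ w → continues last M lo k (a ∷ w) ≡ false
    continues-∷ w rewrite admissible-∷-below M w a<lo | ∧-zeroʳ ((a ≤ᵇ suc last) ∧ steps-ok a w) = refl

  countAfter-above : suc last < a → countAfter m r last M lo k a ≡ 0
  countAfter-above last+1<a = countB-none continues-∷ (words r m)
    where
    continues-∷ : ∀ w → continues last M lo k (a ∷ w) ≡ false
    continues-∷ w rewrite ≤ᵇ≡false last+1<a = refl

  countAfter-inner : a ≤ suc last → last ≤ a → lo ≤ a → a < M →
                     countAfter m r last M lo k a ≡ count m r a M a k
  countAfter-inner a≤last+1 last≤a lo≤a a<M = countB-cong continues-∷ (words r m)
    where
    continues-∷ : ∀ w → continues last M lo k (a ∷ w) ≡ continues a M a k w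
    continues-∷ w rewrite ≤ᵇ≡true a≤last+1 | <ᵇ≡false last≤a | admissible-∷-inner w lo≤a a<M = refl

  countAfter-outer : a ≤ suc last → last ≤ a → lo ≤ a → M ≤ a →
                     countAfter m r last M lo k a ≡ count m r a a lo k
  countAfter-outer a≤last+1 last≤a lo≤a M≤a = countB-cong continues-∷ (words r m)
    where
    continues-∷ : ∀ w → continues last M lo k (a ∷ w) ≡ continues a a lo k w
    continues-∷ w rewrite ≤ᵇ≡true a≤last+1 | <ᵇ≡false last≤a | admissible-∷-outer w lo≤a M≤a = refl

countAfter-descent : ∀ m r k {last M lo a} → a < last → lo ≤ a → a < M →
                     countAfter m r last M lo k a ≡ shiftY (count m r a M a) k
countAfter-descent m r zero {last} {M} {lo} {a} a<last lo≤a a<M =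
  countB-none continues-∷ (words r m)
  where
  continues-∷ : ∀ w → continues last M lo zero (a ∷ w) ≡ false
  continues-∷ w rewrite <ᵇ≡true a<last = ∧-zeroʳ _
countAfter-descent m r (suc k) {last} {M} {lo} {a} a<last lo≤a a<M =
  countB-cong continues-∷ (words r m)
  where
  continues-∷ : ∀ w → continues last M lo (suc k) (a ∷ w) ≡ continues a M a k w
  continues-∷ w rewrite ≤ᵇ≡true (m≤n⇒m≤1+n (<⇒≤ a<last)) | <ᵇ≡true a<last
                      | admissible-∷-inner w lo≤a a<M = refl

mutual
  count-atMax : ∀ r m e lo k → e + lo + r < m → count m r (e + lo) (e + lo) lo k ≡ T r e k
  count-atMax zero    m e lo zero    _     = refl
  count-atMax zero    m e lo (suc k) _     = refl
  count-atMax (suc r) m e lo k       bound = begin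
      count m (suc r) M M lo k
    ≡⟨ countB-words-suc (continues M M lo k) r m ⟩
      sumBelow (countAfter m r M M lo k) m
    ≡⟨ sumBelow-window (countAfter m r M M lo k) lo (2 + e) m window
         (λ _ → countAfter-below m r k) (λ _ → countAfter-above m r k {M = M} {lo = lo}) ⟩
      sumBelow g (2 + e)
    ≡⟨ trans (sumBelow-snoc g (suc e)) (cong (_+ g (suc e)) (sumBelow-snoc g e)) ⟩
      sumBelow g e + g e + g (suc e)
    ≡⟨ cong₂ _+_ (cong₂ _+_ (drops k) stay) climb ⟩
      shiftY (S r e) k + T r e k + T r (suc e) k ∎
    where
    open ≡-Reasoning
    M = e + lo
    g : ℕ → ℕ
    g j = countAfter m r M M lo k (j + lo)
    M+r<m : M + r < m
    M+r<m = <-≤-trans (s≤s (+-monoʳ-≤ M (n≤1+n r))) bound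
    1+M+r<m : suc M + r < m
    1+M+r<m = ≤-trans (≤-reflexive (cong suc (sym (+-suc M r)))) bound
    window : 2 + e + lo ≤ m
    window = ≤-trans (s≤s (s≤s (m≤m+n M r))) 1+M+r<m
    stay : g e ≡ T r e k
    stay = trans (countAfter-outer m r k (n≤1+n M) ≤-refl (m≤n+m lo e) ≤-refl)
                 (count-atMax r m e lo k M+r<m)
    climb : g (suc e) ≡ T r (suc e) k
    climb = trans (countAfter-outer m r k ≤-refl (n≤1+n M) (m≤n+m lo (suc e)) (n≤1+n M))
                  (count-atMax r m (suc e) lo k 1+M+r<m)
    drop : ∀ j → j < e → M ≡ suc (e ∸ suc j) + (j + lo)
    drop j j<e = begin
      e + lo                       ≡⟨ cong (_+ lo) (m∸n+n≡m j<e) ⟨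
      (e ∸ suc j) + suc j + lo     ≡⟨ cong (_+ lo) (+-suc (e ∸ suc j) j) ⟩
      suc (e ∸ suc j) + j + lo     ≡⟨ +-assoc (suc (e ∸ suc j)) j lo ⟩
      suc (e ∸ suc j) + (j + lo)   ∎
    drops : ∀ k → sumBelow (λ j → countAfter m r M M lo k (j + lo)) e ≡ shiftY (S r e) k
    drops zero     = sumBelow-zero e (λ j j<e → let j+lo<M = +-monoˡ-< lo j<e in
                       countAfter-descent m r zero j+lo<M (m≤n+m lo j) j+lo<M)
    drops (suc k′) = trans (sumBelow-cong e (λ j j<e → let j+lo<M = +-monoˡ-< lo j<e in
                       trans (countAfter-descent m r (suc k′) j+lo<M (m≤n+m lo j) j+lo<M)
                             (count-atFloor r m (e ∸ suc j) (j + lo) M k′ (drop j j<e)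
                                (<-trans (+-monoˡ-< r j+lo<M) M+r<m))))
                     (sym (S≡sumBelow r e k′))

  count-atFloor : ∀ r m d p M k → M ≡ suc d + p → p + r < m → count m r p M p k ≡ F r d k
  count-atFloor zero    m d p M zero    _    _     = refl
  count-atFloor zero    m d p M (suc k) _    _     = refl
  count-atFloor (suc r) m d p M k       refl bound = begin
      count m (suc r) p M p k
    ≡⟨ countB-words-suc (continues p M p k) r m ⟩
      sumBelow (countAfter m r p M p k) m
    ≡⟨ sumBelow-window g p 2 m window
         (λ _ → countAfter-below m r k) (λ _ → countAfter-above m r k {M = M} {lo = p}) ⟩
      g p + (g (suc p) + 0)
    ≡⟨ cong₂ _+_ stay (trans (+-identityʳ (g (suc p))) (climb d refl)) ⟩
      F r d k + next d
    ≡⟨ F-suc d ⟩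
      F (suc r) d k ∎
    where
    open ≡-Reasoning
    g : ℕ → ℕ
    g = countAfter m r p M p k
    p+r<m : p + r < m
    p+r<m = <-≤-trans (s≤s (+-monoʳ-≤ p (n≤1+n r))) bound
    1+p+r<m : suc p + r < m
    1+p+r<m = ≤-trans (≤-reflexive (cong suc (sym (+-suc p r)))) bound
    window : 2 + p ≤ m
    window = ≤-trans (s≤s (s≤s (m≤m+n p r))) 1+p+r<m
    stay : g p ≡ F r d k
    stay = trans (countAfter-inner m r k (n≤1+n p) ≤-refl ≤-refl (s≤s (m≤n+m p d)))
                 (count-atFloor r m d p M k refl p+r<m)
    next : ℕ → ℕ
    next zero     = T r 1 k
    next (suc d′) = F r d′ k
    climb : ∀ d′ → d′ ≡ d → g (suc p) ≡ next d′
    climb zero     refl = trans (countAfter-outer m r k ≤-refl (n≤1+n p) (n≤1+n p) ≤-refl)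
                                (count-atMax r m 1 p k 1+p+r<m)
    climb (suc d′) refl = trans (countAfter-inner m r k ≤-refl (n≤1+n p) (n≤1+n p) (s≤s (s≤s (m≤n+m p d′))))
                                (count-atFloor r m d′ (suc p) M k (cong suc (sym (+-suc d′ p))) 1+p+r<m)
    F-suc : ∀ d′ → F r d′ k + next d′ ≡ F (suc r) d′ k
    F-suc zero     = refl
    F-suc (suc d′) = refl

count210 : ℕ → ℕ → ℕ
count210 zero    zero    = 1
count210 zero    (suc k) = 0
count210 (suc n) k       = T n 0 k

cnk-210 : ∀ n k → cnk pat210 n k ≡ count210 n k
cnk-210 zero    zero    = refl
cnk-210 zero    (suc k) = refl
cnk-210 (suc n) k       = begin
    cnk pat210 (suc n) k
  ≡⟨ countB-words-suc good n (suc n) ⟩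
    startingWith 0 + sumBelow (startingWith ∘ suc) n
  ≡⟨ cong₂ _+_ (countB-cong starts-at-0 (words n (suc n)))
               (sumBelow-zero n (λ _ _ → countB-none (λ _ → refl) (words n (suc n)))) ⟩
    count (suc n) n 0 0 0 k + 0
  ≡⟨ +-identityʳ _ ⟩
    count (suc n) n 0 0 0 k
  ≡⟨ count-atMax n (suc n) 0 0 k ≤-refl ⟩
    T n 0 k ∎
  where
  open ≡-Reasoning
  good : List ℕ → Bool
  good w = isCatalan w ∧ avoids pat210 w ∧ (des w ≡ᵇ k)
  startingWith : ℕ → ℕ
  startingWith a = countB (good ∘ (a ∷_)) (words n (suc n))
  starts-at-0 : ∀ w → good (0 ∷ w) ≡ continues 0 0 0 k w
  starts-at-0 w
    rewrite contains-210 (0 ∷ w) | hasBelow-zero w | has21Below-zero w | ∨-identityʳ (has210 w) =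
      sym (∧-assoc (steps-ok 0 w) _ _)

-- Recurrences

shiftY-S-zero : ∀ r k → shiftY (S r 0) k ≡ 0
shiftY-S-zero r zero    = refl
shiftY-S-zero r (suc k) = refl

F-zero≡T-zero : ∀ r k → F r 0 k ≡ T r 0 k
F-zero≡T-zero zero    zero    = refl
F-zero≡T-zero zero    (suc k) = refl
F-zero≡T-zero (suc r) k       = begin
  F r 0 k + T r 1 k                       ≡⟨ cong (_+ T r 1 k) (F-zero≡T-zero r k) ⟩
  T r 0 k + T r 1 k                       ≡⟨ cong (λ z → z + T r 0 k + T r 1 k) (shiftY-S-zero r k) ⟨
  shiftY (S r 0) k + T r 0 k + T r 1 k    ∎
  where open ≡-Reasoning

S-suc : ∀ r e k → S (suc r) (suc e) k ≡ S r (suc e) k + S r e k + T r 1 k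
S-suc r zero    k = regroup (F r 0 k) (T r 1 k)
  where
  regroup : ∀ f t → f + t + 0 ≡ f + 0 + 0 + t
  regroup = solve-∀
S-suc r (suc e) k =
  trans (cong (F r (suc e) k + F r e k +_) (S-suc r e k))
        (regroup (F r (suc e) k) (F r e k) (S r (suc e) k) (S r e k) (T r 1 k))
  where
  regroup : ∀ f₁ f₀ s₁ s₀ t → f₁ + f₀ + (s₁ + s₀ + t) ≡ f₁ + s₁ + (f₀ + s₀) + t
  regroup = solve-∀

shiftY-S-suc : ∀ r e k →
  shiftY (S (suc r) (suc e)) k ≡ shiftY (S r (suc e)) k + shiftY (S r e) k + shiftY (T r 1) k
shiftY-S-suc r e zero    = refl
shiftY-S-suc r e (suc k) = S-suc r e k

S-one : ∀ r k → S r 1 k ≡ T r 0 k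
S-one r k = trans (+-identityʳ (F r 0 k)) (F-zero≡T-zero r k)

T-suc-zero : ∀ r k → T (suc r) 0 k ≡ T r 0 k + T r 1 k
T-suc-zero r k = cong (λ z → z + T r 0 k + T r 1 k) (shiftY-S-zero r k)

T-suc-one : ∀ r k → T (suc r) 1 k ≡ shiftY (T r 0) k + T r 1 k + T r 2 k
T-suc-one r k = cong (λ z → z + T r 1 k + T r 2 k) (shiftY-cong (S-one r) k)

T-suc-two : ∀ r k → T (suc r) 2 k ≡ shiftY (F r 1) k + shiftY (T r 0) k + T r 2 k + T r 3 k
T-suc-two r k = cong (λ z → z + T r 2 k + T r 3 k)
  (trans (shiftY-cong (λ k → cong (F r 1 k +_) (S-one r k)) k) (shiftY-+ (F r 1) (T r 0) k))

shiftY-F-suc-one : ∀ r k → shiftY (F (suc r) 1) k ≡ shiftY (F r 1) k + shiftY (T r 0) k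
shiftY-F-suc-one r k =
  trans (shiftY-cong (λ k → cong (F r 1 k +_) (F-zero≡T-zero r k)) k) (shiftY-+ (F r 1) (T r 0) k)

-- Eliminating S between the recurrences of T and S: the defect of this identity at length
-- suc n is the sum of its defects at length n for e and suc e.
T-relation : ∀ n e k → T (suc n) (3 + e) k + T (suc n) (1 + e) k + T n (2 + e) k + T n (1 + e) k
                     ≡ T (suc n) (2 + e) k + T (suc n) (2 + e) k + T n (3 + e) k + T n e k
T-relation zero    e zero          = refl
T-relation zero    e (suc zero)    = regroup (S 0 e 0)
  where
  regroup : ∀ s → 3 + s + 0 + 0 + (1 + s + 0 + 0) + 0 + 0 ≡ 2 + s + 0 + 0 + (2 + s + 0 + 0) + 0 + 0
  regroup = solve-∀
T-relation zero    e (suc (suc k)) = refl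
T-relation (suc n) e k = +-cancelʳ-≡ _ (L (suc n) e) (R (suc n) e) (begin
    L (suc n) e + (R n (suc e) + R n e)
  ≡⟨ step (T n e k) (T n (1 + e) k) (T n (2 + e) k) (T n (3 + e) k) (T n (4 + e) k) (T n (5 + e) k)
          (shiftY (S n e) k) (shiftY (S n (1 + e)) k) (shiftY (S n (2 + e)) k) (shiftY (S n (3 + e)) k)
          (shiftY (S n (4 + e)) k) (shiftY (T n 1) k) _ _ _
          (shiftY-S-suc n e k) (shiftY-S-suc n (1 + e) k) (shiftY-S-suc n (2 + e) k) ⟩
    R (suc n) e + (L n (suc e) + L n e)
  ≡⟨ cong (R (suc n) e +_) (cong₂ _+_ (T-relation n (suc e) k) (T-relation n e k)) ⟩
    R (suc n) e + (R n (suc e) + R n e) ∎)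
  where
  open ≡-Reasoning
  L R : ℕ → ℕ → ℕ
  L n e = T (suc n) (3 + e) k + T (suc n) (1 + e) k + T n (2 + e) k + T n (1 + e) k
  R n e = T (suc n) (2 + e) k + T (suc n) (2 + e) k + T n (3 + e) k + T n e k
  step : ∀ t₀ t₁ t₂ t₃ t₄ t₅ s₀ s₁ s₂ s₃ s₄ u s′₁ s′₂ s′₃ →
         s′₁ ≡ s₁ + s₀ + u → s′₂ ≡ s₂ + s₁ + u → s′₃ ≡ s₃ + s₂ + u →
         let T₀ = s₀ + t₀ + t₁ ; T₁ = s₁ + t₁ + t₂ ; T₂ = s₂ + t₂ + t₃ ; T₃ = s₃ + t₃ + t₄ ; T₄ = s₄ + t₄ + t₅
             T′₁ = s′₁ + T₁ + T₂ ; T′₂ = s′₂ + T₂ + T₃ ; T′₃ = s′₃ + T₃ + T₄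
         in T′₃ + T′₁ + T₂ + T₁ + ((T₃ + T₃ + t₄ + t₁) + (T₂ + T₂ + t₃ + t₀))
          ≡ T′₂ + T′₂ + T₃ + T₀ + ((T₄ + T₂ + t₃ + t₂) + (T₃ + T₁ + t₂ + t₁))
  step t₀ t₁ t₂ t₃ t₄ t₅ s₀ s₁ s₂ s₃ s₄ u _ _ _ refl refl refl =
    solve (t₀ ∷ t₁ ∷ t₂ ∷ t₃ ∷ t₄ ∷ t₅ ∷ s₀ ∷ s₁ ∷ s₂ ∷ s₃ ∷ s₄ ∷ u ∷ [])

-- The generating function

-- Coefficient of xⁿ⁺⁴ in (1 − 2x)³ a − x²(1 − x)(1 − 2x) u; with a and u the coefficients of
-- yᵏ and yᵏ⁻¹ of a series, this is the coefficient of xⁿ⁺⁴yᵏ of its product with den1 and den2.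
denCoeff : (a u : ℕ → ℤ) → ℕ → ℤ
denCoeff a u n = a (4 + n) -ℤ pos 6 *ℤ a (3 + n) +ℤ pos 12 *ℤ a (2 + n) -ℤ pos 8 *ℤ a (1 + n)
                 -ℤ u (2 + n) +ℤ pos 3 *ℤ u (1 + n) -ℤ pos 2 *ℤ u n

-- After substituting the first four relations, the left-hand side is the defect of the fifth.
linear-elimination : ∀ (t₀ t₁ t₂ t₃ u v : ℕ → ℤ) →
  (∀ m → t₀ (suc m) ≡ t₀ m +ℤ t₁ m) →
  (∀ m → t₁ (suc m) ≡ u m +ℤ t₁ m +ℤ t₂ m) →
  (∀ m → t₂ (suc m) ≡ v m +ℤ u m +ℤ t₂ m +ℤ t₃ m) →
  (∀ m → v (suc m) ≡ v m +ℤ u m) →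
  (∀ m → t₃ (suc m) +ℤ t₁ (suc m) +ℤ t₂ m +ℤ t₁ m ≡ t₂ (suc m) +ℤ t₂ (suc m) +ℤ t₃ m +ℤ t₀ m) →
  ∀ n → denCoeff t₀ u n ≡ pos 0
linear-elimination t₀ t₁ t₂ t₃ u v r₀ r₁ r₂ r₃ κ n =
  trans (substitute (t₀ n) (t₀ (1 + n)) (t₀ (2 + n)) (t₀ (3 + n)) (t₀ (4 + n))
                    (t₁ n) (t₁ (1 + n)) (t₁ (2 + n)) (t₁ (3 + n)) (t₂ n) (t₂ (1 + n)) (t₂ (2 + n))
                    (t₃ n) (t₃ (1 + n)) (u n) (u (1 + n)) (u (2 + n)) (v n) (v (1 + n))
                    (r₀ n) (r₀ (1 + n)) (r₀ (2 + n)) (r₀ (3 + n)) (r₁ n) (r₁ (1 + n)) (r₁ (2 + n))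
                    (r₂ n) (r₂ (1 + n)) (r₃ n))
        (i≡j⇒i-j≡0 (κ n))
  where
  substitute : ∀ a₀ a₁ a₂ a₃ a₄ b₀ b₁ b₂ b₃ c₀ c₁ c₂ d₀ d₁ u₀ u₁ u₂ v₀ v₁ →
    a₁ ≡ a₀ +ℤ b₀ → a₂ ≡ a₁ +ℤ b₁ → a₃ ≡ a₂ +ℤ b₂ → a₄ ≡ a₃ +ℤ b₃ →
    b₁ ≡ u₀ +ℤ b₀ +ℤ c₀ → b₂ ≡ u₁ +ℤ b₁ +ℤ c₁ → b₃ ≡ u₂ +ℤ b₂ +ℤ c₂ →
    c₁ ≡ v₀ +ℤ u₀ +ℤ c₀ +ℤ d₀ → c₂ ≡ v₁ +ℤ u₁ +ℤ c₁ +ℤ d₁ → v₁ ≡ v₀ +ℤ u₀ →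
    a₄ -ℤ pos 6 *ℤ a₃ +ℤ pos 12 *ℤ a₂ -ℤ pos 8 *ℤ a₁ -ℤ u₂ +ℤ pos 3 *ℤ u₁ -ℤ pos 2 *ℤ u₀
      ≡ d₁ +ℤ b₁ +ℤ c₀ +ℤ b₀ -ℤ (c₁ +ℤ c₁ +ℤ d₀ +ℤ a₀)
  substitute a₀ _ _ _ _ b₀ _ _ _ c₀ _ _ d₀ d₁ u₀ u₁ u₂ v₀ _
             refl refl refl refl refl refl refl refl refl refl =
    ℤsolve (a₀ ∷ b₀ ∷ c₀ ∷ d₀ ∷ d₁ ∷ u₀ ∷ u₁ ∷ u₂ ∷ v₀ ∷ [])

T₀-recurrence : ∀ n k → denCoeff (λ m → pos (T m 0 k)) (λ m → pos (shiftY (T m 0) k)) n ≡ pos 0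
T₀-recurrence n k =
  linear-elimination (t 0) (t 1) (t 2) (t 3) (λ m → pos (shiftY (T m 0) k)) (λ m → pos (shiftY (F m 1) k))
    (λ m → cong pos (T-suc-zero m k)) (λ m → cong pos (T-suc-one m k)) (λ m → cong pos (T-suc-two m k))
    (λ m → cong pos (shiftY-F-suc-one m k)) (λ m → cong pos (T-relation m 0 k)) n
  where
  t : ℕ → ℕ → ℤ
  t e m = pos (T m e k)

⊛-cong : ∀ (ps : Poly) {f g : Series} → (∀ n k → f n k ≡ g n k) → ∀ n k → (ps ⊛ f) n k ≡ (ps ⊛ g) n k
⊛-cong []                  f≗g n k = refl
⊛-cong ((a , i , j) ∷ ps) f≗g n k =
  cong₂ _+ℤ_ (cong (λ z → if (i ≤ᵇ n) ∧ (j ≤ᵇ k) then a *ℤ z else pos 0) (f≗g (n ∸ i) (k ∸ j)))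
             (⊛-cong ps f≗g n k)

⊛-denominators : ∀ (c : ℕ → ℕ → ℕ) n k →
  (den1 ⊛ den2 ⊛ (λ n k → pos (c n k))) (4 + n) k
    ≡ denCoeff (λ m → pos (c m k)) (λ m → pos (shiftY (c m) k)) n
⊛-denominators c n zero =
  expand₀ (pos (c (4 + n) 0)) (pos (c (3 + n) 0)) (pos (c (2 + n) 0)) (pos (c (1 + n) 0))
  where
  expand₀ : ∀ g₄ g₃ g₂ g₁ →
    pos 1 *ℤ (pos 1 *ℤ g₄ +ℤ (- pos 4 *ℤ g₃ +ℤ (pos 4 *ℤ g₂ +ℤ pos 0)))
      +ℤ (- pos 2 *ℤ (pos 1 *ℤ g₃ +ℤ (- pos 4 *ℤ g₂ +ℤ (pos 4 *ℤ g₁ +ℤ pos 0))) +ℤ pos 0)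
    ≡ g₄ -ℤ pos 6 *ℤ g₃ +ℤ pos 12 *ℤ g₂ -ℤ pos 8 *ℤ g₁ -ℤ pos 0 +ℤ pos 3 *ℤ pos 0 -ℤ pos 2 *ℤ pos 0
  expand₀ = ℤsolve-∀
⊛-denominators c n (suc k) =
  expand (pos (c (4 + n) (suc k))) (pos (c (3 + n) (suc k))) (pos (c (2 + n) (suc k))) (pos (c (1 + n) (suc k)))
         (pos (c (2 + n) k)) (pos (c (1 + n) k)) (pos (c n k))
  where
  expand : ∀ g₄ g₃ g₂ g₁ h₂ h₁ h₀ →
    pos 1 *ℤ (pos 1 *ℤ g₄ +ℤ (- pos 4 *ℤ g₃ +ℤ (pos 4 *ℤ g₂ +ℤ (- pos 1 *ℤ h₂ +ℤ (pos 1 *ℤ h₁ +ℤ pos 0)))))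
      +ℤ (- pos 2 *ℤ (pos 1 *ℤ g₃ +ℤ (- pos 4 *ℤ g₂ +ℤ (pos 4 *ℤ g₁ +ℤ (- pos 1 *ℤ h₁ +ℤ (pos 1 *ℤ h₀ +ℤ pos 0)))))
          +ℤ pos 0)
    ≡ g₄ -ℤ pos 6 *ℤ g₃ +ℤ pos 12 *ℤ g₂ -ℤ pos 8 *ℤ g₁ -ℤ h₂ +ℤ pos 3 *ℤ h₁ -ℤ pos 2 *ℤ h₀
  expand = ℤsolve-∀

coefficients : ∀ n k → (den1 ⊛ den2 ⊛ (λ n k → pos (count210 n k))) n k ≡ coeffP num210 n k
coefficients 0 0             = refl
coefficients 0 1             = refl
coefficients 0 (suc (suc k)) = refl
coefficients 1 0             = refl
coefficients 1 1             = refl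
coefficients 1 (suc (suc k)) = refl
coefficients 2 0             = refl
coefficients 2 1             = refl
coefficients 2 (suc (suc k)) = refl
coefficients 3 0             = refl
coefficients 3 1             = refl
coefficients 3 (suc (suc k)) = refl
coefficients 4 0             = refl
coefficients 4 1             = refl
coefficients 4 (suc (suc k)) = refl
coefficients (suc (suc (suc (suc (suc n))))) k =
  trans (⊛-denominators count210 (suc n) k) (T₀-recurrence n k)

theorem13 : (n k : ℕ) → (den1 ⊛ den2 ⊛ Cser pat210) n k ≡ coeffP num210 n k
theorem13 n k =
  trans (⊛-cong den1 (⊛-cong den2 (λ n k → cong pos (cnk-210 n k))) n k) (coefficients n k)
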